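{- Let $T_1,T_2$ be two trees on the same label set $\mathcal{X}$. If there is an LPR sequence $(x_1,\ldots,x_k)$ turning $T_1$ into $T_2$, then for any $i\in\{1,\ldots,k\}$ there is an LPR sequence $(x'_1,\ldots,x'_k)$ turning $T_1$ into $T_2$ such that $x'_1=x_i$ and $\{x_1,\ldots,x_k\}=\{x'_1,\ldots,x'_k\}$.
   Context: All trees are rooted binary phylogenetic trees: rooted trees in which every non-leaf node has exactly two children, whose leaves are bijectively labeled by a finite label set $\mathcal{X}(T)$; two trees are equal if there is a label-preserving isomorphism between them. For $L\subseteq\mathcal{X}(T)$, $T-L$ is the tree obtained from $T$ by removing every leaf labeled by an element of $L$, contracting the resulting non-root vertices of degree two, and repeatedly deleting the root while it has degree one. Grafting a single leaf $\ell$ on an edge $e$ of a tree means subdividing $e$ and making the new degree-2 node the parent of $\ell$; grafting $\ell$ above a tree means creating a new root whose children are the old root and $\ell$. An LPR (leaf prune-and-regraft) move on a tree $T$ with label set $\mathcal{X}$ is a pair $(\ell,e)$ with $\ell\in\mathcal{X}$ and $e$ either an edge of $T-\{\ell\}$ or the symbol $\perp$; applying it means grafting $\ell$ on edge $e$ of $T-\{\ell\}$ if $e\neq\perp$, and above the root of $T-\{\ell\}$ if $e=\perp$. An LPR sequence $((\ell_1,e_1),\ldots,(\ell_k,e_k))$ is a tuple of LPR moves where each $(\ell_i,e_i)$ is an LPR move on the tree obtained after applying the first $i-1$ moves; it is also written $(\ell_1,\ldots,\ell_k)$ when the grafting locations need not be specified. It turns $T_1$ into $T_2$ if applying its moves in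 order to $T_1$ yields $T_2$. -}

module Defs where

open import Data.Nat using (ℕ; _≟_)
open import Data.List using (List; []; _∷_; _++_; [_])
open import Data.Maybe using (Maybe; just; nothing)
open import Data.Product using (_×_)
open import Data.Sum using (_⊎_)
open import Data.Unit using (⊤)
open import Data.List.Relation.Unary.Unique.Propositional using (Unique)
open import Relation.Nullary using (yes; no)

-- Rooted binary trees with leaves labelled by natural numbers.
-- (Children are ordered in the representation; equality of phylogenetic
-- trees is the label-preserving isomorphism relation _≅_ below.)
data Tree : Set where
  leaf : ℕ → Tree
  node : Tree → Tree → Tree

labels : Tree → List ℕ
labels (leaf x)   = [ x ]
labels (node l r) = labels l ++ labels r

Phylo : Tree → Set
Phylo t = Unique (labels t)

data _≅_ : Tree → Tree → Set where
  leaf≅ : ∀ x → leaf x ≅ leaf x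
  node≅ : ∀ {l r l′ r′} → l ≅ l′ → r ≅ r′ → node l r ≅ node l′ r′
  swap≅ : ∀ {l r l′ r′} → l ≅ r′ → r ≅ l′ → node l r ≅ node l′ r′

data Pos : Tree → Set where
  here  : ∀ {t} → Pos t
  left  : ∀ {l r} → Pos l → Pos (node l r)
  right : ∀ {l r} → Pos r → Pos (node l r)

-- edges of a tree: each edge is identified with its lower (child) endpoint,
-- i.e. with a non-root node
data Edge : Tree → Set where
  inL : ∀ {l r} → Pos l → Edge (node l r)
  inR : ∀ {l r} → Pos r → Edge (node l r)

-- graft leaf ℓ above the subtree rooted at a node (i.e. subdivide the
-- edge entering that node, or create a new root if the node is the root)
graftAt : (ℓ : ℕ) (t : Tree) → Pos t → Tree
graftAt ℓ t          here      = node t (leaf ℓ)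
graftAt ℓ (node l r) (left p)  = node (graftAt ℓ l p) r
graftAt ℓ (node l r) (right p) = node l (graftAt ℓ r p)

graftEdge : (ℓ : ℕ) (t : Tree) → Edge t → Tree
graftEdge ℓ (node l r) (inL p) = node (graftAt ℓ l p) r
graftEdge ℓ (node l r) (inR p) = node l (graftAt ℓ r p)

-- T - {ℓ}; nothing represents the empty tree.
-- Removing a leaf, contracting the non-root degree-2 vertex, and deleting a
-- root of degree one all amount to replacing the parent of ℓ by ℓ's sibling.
remove : ℕ → Tree → Maybe Tree
remove ℓ (leaf x) with x ≟ ℓ
... | yes _ = nothing
... | no  _ = just (leaf x)
remove ℓ (node l r) with remove ℓ l | remove ℓ r
... | just l′  | just r′  = just (node l′ r′)
... | just l′  | nothing  = just l′
... | nothing  | just r′  = just r′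
... | nothing  | nothing  = nothing

-- possible grafting locations in T - {ℓ}: an edge, or ⊥ (= nothing)
Loc : Maybe Tree → Set
Loc nothing  = ⊤
Loc (just t) = Maybe (Edge t)

graft : (ℓ : ℕ) (m : Maybe Tree) → Loc m → Tree
graft ℓ nothing  _          = leaf ℓ
graft ℓ (just t) nothing    = node t (leaf ℓ)
graft ℓ (just t) (just e)   = graftEdge ℓ t e

open import Data.List.Membership.Propositional using (_∈_)

record Move (t : Tree) : Set where
  constructor move
  field
    lab  : ℕ
    lab∈ : lab ∈ labels t
    loc  : Loc (remove lab t)

applyMove : (t : Tree) → Move t → Tree
applyMove t (move ℓ _ e) = graft ℓ (remove ℓ t) e

data LPRSeq : Tree → Set where
  []  : ∀ {t} → LPRSeq t
  _∷_ : ∀ {t} (m : Move t) → LPRSeq (applyMove t m) → LPRSeq t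

result : ∀ {t} → LPRSeq t → Tree
result {t} []       = t
result     (m ∷ s)  = result s

moved : ∀ {t} → LPRSeq t → List ℕ
moved []       = []
moved (m ∷ s)  = Move.lab m ∷ moved s

Turns : ∀ {T₁} → LPRSeq T₁ → Tree → Set
Turns s T₂ = result s ≅ T₂

module Submission where

-- Write T|ys for T with the leaves in ys deleted.  Two converse facts:
--  * agreeOff: moving a label outside ys leaves T|ys unchanged, so if an LPR
--    sequence moving only labels of ys turns T₁ into T₂, then T₁|ys ≅ T₂|ys.
--  * realise: if T|ys ≅ T₂|ys, T₂ has distinct labels and ys occurs in T and
--    T₂, some LPR sequence moving exactly ys, in this order, turns T into T₂.
--    Induction on ys = y ∷ ys′: if y ∈ ys′ it is moved anywhere; otherwise it
--    is regrafted at the site it occupies in T₂|ys′, transported to T − {y}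
--    along (T − {y})|ys′ ≅ T₂|(y ∷ ys′).
-- Hence every permutation of the moved labels is realisable (reorder), and
-- lemma4 is the one bringing x_i to the front.

open import Data.Bool using (Bool; true; false; not; _∧_; if_then_else_)
open import Data.Bool.Properties using (T-≡; ∧-comm)
open import Data.Fin using (Fin; zero; suc)
open import Data.List using (List; []; _∷_; _++_; [_]; length; lookup; removeAt; filter)
open import Data.List.Properties using (++-identityʳ; filter-++)
open import Data.List.Membership.Propositional using (_∈_; _∉_)
open import Data.List.Membership.Propositional.Properties using (∈-++⁺ˡ; ∈-++⁺ʳ; ∈-++⁻; ∈-filter⁺; ∈-filter⁻)
open import Data.List.Relation.Binary.Permutation.Propositional using (_↭_; ↭-refl; ↭-sym; ↭-trans; prep; swap)
open import Data.List.Relation.Binary.Permutation.Propositional.Properties using (∈-resp-↭; ↭-length; ++⁺ˡ; ++⁺ʳ; ++-comm; shift)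
open import Data.List.Relation.Binary.Subset.Propositional using (_⊆_)
import Data.List.Relation.Unary.All as All
open import Data.List.Relation.Unary.All.Properties using (++⁻ˡ; ++⁻ʳ)
open import Data.List.Relation.Unary.AllPairs using ([]; _∷_)
open import Data.List.Relation.Unary.Any using (here; there)
open import Data.List.Relation.Unary.Unique.Propositional using (Unique)
import Data.List.Relation.Unary.Unique.Propositional.Properties as Unique
open import Data.Maybe using (Maybe; just; nothing)
open import Data.Maybe.Relation.Binary.Pointwise as Pointwise using (Pointwise; just; nothing; drop-just)
open import Data.Nat using (ℕ; _≟_)
open import Data.Product using (Σ; ∃; _×_; _,_; proj₁)
open import Data.Sum using (inj₁; inj₂)
open import Data.Unit using (⊤; tt)
open import Function using (_∘_)
open import Function.Bundles using (_⇔_; mk⇔; Equivalence)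
open import Relation.Binary.Bundles using (Setoid)
open import Relation.Binary.PropositionalEquality using (_≡_; _≢_; refl; sym; trans; cong; cong₂; subst; module ≡-Reasoning)
import Relation.Binary.Reasoning.Setoid as SetoidReasoning
open import Relation.Nullary using (Dec; yes; no; does)
open import Relation.Nullary.Decidable using (T?; dec-true; dec-false)
open import Data.List.Membership.DecPropositional _≟_ using (_∈?_)
open import Defs

≅-refl : ∀ {t} → t ≅ t
≅-refl {leaf x}   = leaf≅ x
≅-refl {node l r} = node≅ ≅-refl ≅-refl

≅-sym : ∀ {a b} → a ≅ b → b ≅ a
≅-sym (leaf≅ x)   = leaf≅ x
≅-sym (node≅ p q) = node≅ (≅-sym p) (≅-sym q)
≅-sym (swap≅ p q) = swap≅ (≅-sym q) (≅-sym p)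

≅-trans : ∀ {a b c} → a ≅ b → b ≅ c → a ≅ c
≅-trans (leaf≅ x)   (leaf≅ .x)    = leaf≅ x
≅-trans (node≅ p q) (node≅ p′ q′) = node≅ (≅-trans p p′) (≅-trans q q′)
≅-trans (node≅ p q) (swap≅ p′ q′) = swap≅ (≅-trans p p′) (≅-trans q q′)
≅-trans (swap≅ p q) (node≅ p′ q′) = swap≅ (≅-trans p q′) (≅-trans q p′)
≅-trans (swap≅ p q) (swap≅ p′ q′) = node≅ (≅-trans p q′) (≅-trans q p′)

≅-setoid : Setoid _ _
≅-setoid = record
  { Carrier       = Tree
  ; _≈_           = _≅_
  ; isEquivalence = record { refl = ≅-refl ; sym = ≅-sym ; trans = ≅-trans }
  }

-- Deleting leaves may empty a tree, so restrictions live in Maybe Tree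
-- (nothing is the empty tree); isomorphism lifts pointwise.
_≅ᴹ_ : Maybe Tree → Maybe Tree → Set
_≅ᴹ_ = Pointwise _≅_

≅ᴹ-setoid : Setoid _ _
≅ᴹ-setoid = Pointwise.setoid ≅-setoid

open Setoid ≅ᴹ-setoid using () renaming (refl to ≅ᴹ-refl; trans to ≅ᴹ-trans)

labelsM : Maybe Tree → List ℕ
labelsM nothing  = []
labelsM (just t) = labels t

-- The tree with two given subtrees, where an empty subtree is omitted
-- (so that no vertex of degree two arises).
nodeM : Maybe Tree → Maybe Tree → Maybe Tree
nodeM (just l) (just r) = just (node l r)
nodeM (just l) nothing  = just l
nodeM nothing  b        = b

nodeM-nothingʳ : ∀ a → nodeM a nothing ≡ a
nodeM-nothingʳ (just _) = refl
nodeM-nothingʳ nothing  = refl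

labelsM-nodeM : ∀ a b → labelsM (nodeM a b) ≡ labelsM a ++ labelsM b
labelsM-nodeM (just l) (just r) = refl
labelsM-nodeM (just l) nothing  = sym (++-identityʳ (labels l))
labelsM-nodeM nothing  b        = refl

nodeM-resp : ∀ {a a′ b b′} → a ≅ᴹ a′ → b ≅ᴹ b′ → nodeM a b ≅ᴹ nodeM a′ b′
nodeM-resp nothing  q        = q
nodeM-resp (just p) nothing  = just p
nodeM-resp (just p) (just q) = just (node≅ p q)

nodeM-comm : ∀ a b → nodeM a b ≅ᴹ nodeM b a
nodeM-comm (just l) (just r) = just (swap≅ ≅-refl ≅-refl)
nodeM-comm (just l) nothing  = ≅ᴹ-refl
nodeM-comm nothing  (just r) = ≅ᴹ-refl
nodeM-comm nothing  nothing  = nothing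

-- T|P: the tree induced by the leaves whose label satisfies P (empty if
-- there are none); a leaf's parent disappears together with the leaf.
restrict : (ℕ → Bool) → Tree → Maybe Tree
restrict P (leaf x)   = if P x then just (leaf x) else nothing
restrict P (node l r) = nodeM (restrict P l) (restrict P r)

restrictM : (ℕ → Bool) → Maybe Tree → Maybe Tree
restrictM P nothing  = nothing
restrictM P (just t) = restrict P t

restrict-leaf : ∀ P {x b} → P x ≡ b → restrict P (leaf x) ≡ (if b then just (leaf x) else nothing)
restrict-leaf P refl = refl

restrictM-nodeM : ∀ P a b → restrictM P (nodeM a b) ≡ nodeM (restrictM P a) (restrictM P b)
restrictM-nodeM P (just l) (just r) = refl
restrictM-nodeM P (just l) nothing  = sym (nodeM-nothingʳ (restrict P l))
restrictM-nodeM P nothing  b        = refl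

restrict-≅ : ∀ P {A B} → A ≅ B → restrict P A ≅ᴹ restrict P B
restrict-≅ P (leaf≅ x)   = ≅ᴹ-refl
restrict-≅ P (node≅ p q) = nodeM-resp (restrict-≅ P p) (restrict-≅ P q)
restrict-≅ P (swap≅ {l′ = l′} {r′ = r′} p q) =
  ≅ᴹ-trans (nodeM-resp (restrict-≅ P p) (restrict-≅ P q)) (nodeM-comm (restrict P r′) (restrict P l′))

restrict-cong : ∀ {P Q} → (∀ x → P x ≡ Q x) → ∀ t → restrict P t ≡ restrict Q t
restrict-cong P≗Q (leaf x) rewrite P≗Q x = refl
restrict-cong P≗Q (node l r) = cong₂ nodeM (restrict-cong P≗Q l) (restrict-cong P≗Q r)

restrict-comp : ∀ P Q t → restrictM P (restrict Q t) ≡ restrict (λ x → Q x ∧ P x) t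
restrict-comp P Q (leaf x) with Q x
... | true  = refl
... | false = refl
restrict-comp P Q (node l r) =
  trans (restrictM-nodeM P (restrict Q l) (restrict Q r))
        (cong₂ nodeM (restrict-comp P Q l) (restrict-comp P Q r))

restrict-all : ∀ P t → (∀ {x} → x ∈ labels t → P x ≡ true) → restrict P t ≡ just t
restrict-all P (leaf x) all rewrite all (here refl) = refl
restrict-all P (node l r) all
  rewrite restrict-all P l (all ∘ ∈-++⁺ˡ) | restrict-all P r (all ∘ ∈-++⁺ʳ (labels l)) = refl

kept : (ℕ → Bool) → List ℕ → List ℕ
kept P = filter (λ x → T? (P x))

labels-restrict : ∀ P t → labelsM (restrict P t) ≡ kept P (labels t)
labels-restrict P (leaf x) with P x
... | true  = refl
... | false = refl
labels-restrict P (node l r) = begin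
  labelsM (nodeM (restrict P l) (restrict P r))      ≡⟨ labelsM-nodeM (restrict P l) (restrict P r) ⟩
  labelsM (restrict P l) ++ labelsM (restrict P r)   ≡⟨ cong₂ _++_ (labels-restrict P l) (labels-restrict P r) ⟩
  kept P (labels l) ++ kept P (labels r)             ≡⟨ filter-++ (λ x → T? (P x)) (labels l) (labels r) ⟨
  kept P (labels l ++ labels r)                      ∎
  where open ≡-Reasoning

∈-restrict⁺ : ∀ P t {z} → z ∈ labels t → P z ≡ true → z ∈ labelsM (restrict P t)
∈-restrict⁺ P t z∈ Pz =
  subst (_ ∈_) (sym (labels-restrict P t)) (∈-filter⁺ (λ x → T? (P x)) z∈ (Equivalence.from T-≡ Pz))

∈-restrict⁻ : ∀ P t {z} → z ∈ labelsM (restrict P t) → z ∈ labels t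
∈-restrict⁻ P t z∈ = proj₁ (∈-filter⁻ (λ x → T? (P x)) (subst (_ ∈_) (labels-restrict P t) z∈))

restrict-unique : ∀ P t → Unique (labels t) → Unique (labelsM (restrict P t))
restrict-unique P t u = subst Unique (sym (labels-restrict P t)) (Unique.filter⁺ (λ x → T? (P x)) u)

other : ℕ → ℕ → Bool
other ℓ x = not (does (x ≟ ℓ))

outside : List ℕ → ℕ → Bool
outside ys x = not (does (x ∈? ys))

other-self : ∀ ℓ → other ℓ ℓ ≡ false
other-self ℓ = cong not (dec-true (ℓ ≟ ℓ) refl)

other-true : ∀ {ℓ x} → x ≢ ℓ → other ℓ x ≡ true
other-true {ℓ} {x} x≢ℓ = cong not (dec-false (x ≟ ℓ) x≢ℓ)

outside-false : ∀ {ys z} → z ∈ ys → outside ys z ≡ false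
outside-false {ys} {z} z∈ = cong not (dec-true (z ∈? ys) z∈)

outside-true : ∀ {ys z} → z ∉ ys → outside ys z ≡ true
outside-true {ys} {z} z∉ = cong not (dec-false (z ∈? ys) z∉)

other-∧ : ∀ (P : ℕ → Bool) {ℓ} → P ℓ ≡ false → ∀ x → other ℓ x ∧ P x ≡ P x
other-∧ P {ℓ} Pℓ x with x ≟ ℓ
... | yes refl rewrite other-self ℓ = sym Pℓ
... | no  x≢ℓ  rewrite other-true x≢ℓ = refl

outside-∷ : ∀ y ys x → outside (y ∷ ys) x ≡ other y x ∧ outside ys x
outside-∷ y ys x with x ≟ y
... | yes refl rewrite outside-false {y ∷ ys} (here refl) | other-self y = refl
... | no  x≢y  rewrite dec-false (x ≟ y) x≢y = refl

outside-dup : ∀ {y ys} → y ∈ ys → ∀ x → outside (y ∷ ys) x ≡ outside ys x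
outside-dup {y} {ys} y∈ x with x ≟ y
... | yes refl rewrite outside-false {y ∷ ys} (here refl) = sym (outside-false y∈)
... | no  x≢y  rewrite outside-∷ y ys x | other-true x≢y = refl

remove-node : ∀ ℓ l r → remove ℓ (node l r) ≡ nodeM (remove ℓ l) (remove ℓ r)
remove-node ℓ l r with remove ℓ l | remove ℓ r
... | just _  | just _  = refl
... | just _  | nothing = refl
... | nothing | just _  = refl
... | nothing | nothing = refl

remove≡restrict : ∀ ℓ t → remove ℓ t ≡ restrict (other ℓ) t
remove≡restrict ℓ (leaf x) with x ≟ ℓ
... | yes refl rewrite other-self ℓ  = refl
... | no  x≢ℓ  rewrite other-true x≢ℓ = refl
remove≡restrict ℓ (node l r) =
  trans (remove-node ℓ l r) (cong₂ nodeM (remove≡restrict ℓ l) (remove≡restrict ℓ r))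

restrict-remove : ∀ P ℓ t → restrictM P (remove ℓ t) ≡ restrict (λ x → other ℓ x ∧ P x) t
restrict-remove P ℓ t = trans (cong (restrictM P) (remove≡restrict ℓ t)) (restrict-comp P (other ℓ) t)

restrict-remove-outside : ∀ y ys t → restrictM (outside ys) (remove y t) ≡ restrict (outside (y ∷ ys)) t
restrict-remove-outside y ys t =
  trans (restrict-remove (outside ys) y t) (sym (restrict-cong (outside-∷ y ys) t))

restrict-other-outside : ∀ y ys t → restrictM (other y) (restrict (outside ys) t) ≡ restrict (outside (y ∷ ys)) t
restrict-other-outside y ys t =
  trans (restrict-comp (other y) (outside ys) t)
        (restrict-cong (λ x → trans (∧-comm (outside ys x) (other y x)) (sym (outside-∷ y ys x))) t)

Site : Maybe Tree → Set
Site nothing  = ⊤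
Site (just t) = Pos t

attach : ℕ → (m : Maybe Tree) → Site m → Tree
attach y nothing  _ = leaf y
attach y (just t) p = graftAt y t p

toLoc : ∀ m → Site m → Loc m
toLoc nothing           _         = tt
toLoc (just t)          here      = nothing
toLoc (just (node l r)) (left p)  = just (inL p)
toLoc (just (node l r)) (right p) = just (inR p)

graft-toLoc : ∀ y m (q : Site m) → graft y m (toLoc m q) ≡ attach y m q
graft-toLoc y nothing           _         = refl
graft-toLoc y (just t)          here      = refl
graft-toLoc y (just (node l r)) (left p)  = refl
graft-toLoc y (just (node l r)) (right p) = refl

fromLoc : ∀ m → Loc m → Site m
fromLoc nothing           _             = tt
fromLoc (just t)          nothing       = here
fromLoc (just (node l r)) (just (inL p)) = left p
fromLoc (just (node l r)) (just (inR p)) = right p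

graft-fromLoc : ∀ y m (L : Loc m) → graft y m L ≡ attach y m (fromLoc m L)
graft-fromLoc y nothing           _              = refl
graft-fromLoc y (just t)          nothing        = refl
graft-fromLoc y (just (node l r)) (just (inL p)) = refl
graft-fromLoc y (just (node l r)) (just (inR p)) = refl

aboveRoot : ∀ m → Loc m
aboveRoot nothing  = tt
aboveRoot (just _) = nothing

labels-graftAt : ∀ y t (p : Pos t) → labels (graftAt y t p) ↭ y ∷ labels t
labels-graftAt y t          here      = ++-comm (labels t) [ y ]
labels-graftAt y (node l r) (left p)  = ++⁺ʳ (labels r) (labels-graftAt y l p)
labels-graftAt y (node l r) (right p) = ↭-trans (++⁺ˡ (labels l) (labels-graftAt y r p)) (shift y (labels l) (labels r))

labels-attach : ∀ y m (q : Site m) → labels (attach y m q) ↭ y ∷ labelsM m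
labels-attach y nothing  _ = ↭-refl
labels-attach y (just t) p = labels-graftAt y t p

restrict-graftAt-dropped : ∀ P {y} t (p : Pos t) → P y ≡ false → restrict P (graftAt y t p) ≡ restrict P t
restrict-graftAt-dropped P t here Py rewrite Py = nodeM-nothingʳ _
restrict-graftAt-dropped P (node l r) (left p) Py = cong (λ a → nodeM a (restrict P r)) (restrict-graftAt-dropped P l p Py)
restrict-graftAt-dropped P (node l r) (right p) Py = cong (nodeM (restrict P l)) (restrict-graftAt-dropped P r p Py)

restrict-graft-dropped : ∀ P {y} m (L : Loc m) → P y ≡ false → restrict P (graft y m L) ≡ restrictM P m
restrict-graft-dropped P nothing  _ Py rewrite Py = refl
restrict-graft-dropped P {y} (just t) L Py =
  trans (cong (restrict P) (graft-fromLoc y (just t) L)) (restrict-graftAt-dropped P t (fromLoc (just t) L) Py)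

transportPos : ∀ y {A B} → A ≅ B → (q : Pos B) → Σ (Pos A) λ p → graftAt y A p ≅ graftAt y B q
transportPos y iso here = here , node≅ iso (leaf≅ y)
transportPos y (node≅ i j) (left q)  = let p , e = transportPos y i q in left p , node≅ e j
transportPos y (node≅ i j) (right q) = let p , e = transportPos y j q in right p , node≅ i e
transportPos y (swap≅ i j) (left q)  = let p , e = transportPos y j q in right p , swap≅ i e
transportPos y (swap≅ i j) (right q) = let p , e = transportPos y i q in left p , swap≅ e j

transportSite : ∀ y {a b} → a ≅ᴹ b → (q : Site b) → Σ (Site a) λ p → attach y a p ≅ attach y b q
transportSite y nothing    tt = tt , leaf≅ y
transportSite y (just iso) q  = transportPos y iso q

module _ (P : ℕ → Bool) (y : ℕ) (Py : P y ≡ true) where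

  restrict-aboveRoot : ∀ t {a} → restrict P t ≡ a → restrict P (node t (leaf y)) ≡ nodeM a (just (leaf y))
  restrict-aboveRoot t refl = cong (nodeM (restrict P t)) (restrict-leaf P Py)

  -- The lifting for nonempty trees; a is T|P, kept abstract so that its
  -- shape can be analysed by the case split.
  liftPos : ∀ t {a} → restrict P t ≡ a → (q : Site a) →
    Σ (Pos t) λ p → restrict P (graftAt y t p) ≡ just (attach y a q)
  liftPos (leaf x) refl q with P x in Px
  liftPos (leaf x) refl here | true  = here , restrict-aboveRoot (leaf x) (restrict-leaf P Px)
  liftPos (leaf x) refl tt   | false = here , restrict-aboveRoot (leaf x) (restrict-leaf P Px)
  liftPos (node l r) refl q with restrict P l in el | restrict P r in er
  liftPos (node l r) refl here      | just _ | just _ = here , restrict-aboveRoot (node l r) (cong₂ nodeM el er)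
  liftPos (node l r) refl (left q)  | just _ | just _ = let p , e = liftPos l el q in left p , cong₂ nodeM e er
  liftPos (node l r) refl (right q) | just _ | just _ = let p , e = liftPos r er q in right p , cong₂ nodeM el e
  liftPos (node l r) refl q | just _  | nothing = let p , e = liftPos l el q in left p , cong₂ nodeM e er
  liftPos (node l r) refl q | nothing | just _  = let p , e = liftPos r er q in right p , cong₂ nodeM el e
  liftPos (node l r) refl tt | nothing | nothing = here , restrict-aboveRoot (node l r) (cong₂ nodeM el er)

  liftSite : ∀ m (q : Site (restrictM P m)) →
    Σ (Site m) λ p → restrict P (attach y m p) ≡ just (attach y (restrictM P m) q)
  liftSite nothing  tt = tt , restrict-leaf P Py
  liftSite (just t) q  = liftPos t refl q

unique-++⁻ : ∀ (xs : List ℕ) {ys} → Unique (xs ++ ys) → Unique xs × Unique ys × (∀ {z} → z ∈ xs → z ∉ ys)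
unique-++⁻ []       u           = [] , u , λ ()
unique-++⁻ (x ∷ xs) (x∉ ∷ u) with unique-++⁻ xs u
... | uxs , uys , disjoint = ++⁻ˡ xs x∉ ∷ uxs , uys , λ
  { (here refl) z∈ys → All.lookup (++⁻ʳ xs x∉) z∈ys refl
  ; (there z∈xs)     → disjoint z∈xs }

siteˡ : ∀ {y l r} a → Σ (Site a) (λ q → attach y a q ≅ l) →
  Σ (Site (nodeM a (just r))) λ q → attach y (nodeM a (just r)) q ≅ node l r
siteˡ (just _) (q , iso)  = left q , node≅ iso ≅-refl
siteˡ nothing  (tt , iso) = here , swap≅ ≅-refl iso

siteʳ : ∀ {y l r} b → Σ (Site b) (λ q → attach y b q ≅ r) →
  Σ (Site (nodeM (just l) b)) λ q → attach y (nodeM (just l) b) q ≅ node l r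
siteʳ (just _) (q , iso)  = right q , node≅ ≅-refl iso
siteʳ nothing  (tt , iso) = here , node≅ ≅-refl iso

siteOf : ∀ y t → Unique (labels t) → y ∈ labels t →
  Σ (Site (restrict (other y) t)) λ q → attach y (restrict (other y) t) q ≅ t
siteOf y (leaf .y) _ (here refl) rewrite other-self y = tt , leaf≅ y
siteOf y (node l r) u y∈ with unique-++⁻ (labels l) u | ∈-++⁻ (labels l) y∈
... | ul , _ , disjoint | inj₁ y∈l
  rewrite restrict-all (other y) r (λ {x} x∈r → other-true {y} {x} λ { refl → disjoint y∈l x∈r })
  = siteˡ (restrict (other y) l) (siteOf y l ul y∈l)
... | _ , ur , disjoint | inj₂ y∈r
  rewrite restrict-all (other y) l (λ {x} x∈l → other-true {y} {x} λ { refl → disjoint x∈l y∈r })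
  = siteʳ (restrict (other y) r) (siteOf y r ur y∈r)

siteOfM : ∀ y m → Unique (labelsM m) → y ∈ labelsM m →
  Σ (Site (restrictM (other y) m)) λ q → just (attach y (restrictM (other y) m) q) ≅ᴹ m
siteOfM y nothing  _ ()
siteOfM y (just t) u y∈ = let q , iso = siteOf y t u y∈ in q , just iso

labels-applyMove : ∀ t (m : Move t) → labels (applyMove t m) ↭ Move.lab m ∷ labelsM (remove (Move.lab m) t)
labels-applyMove t (move ℓ _ L) rewrite graft-fromLoc ℓ (remove ℓ t) L =
  labels-attach ℓ (remove ℓ t) (fromLoc (remove ℓ t) L)

∈-applyMove⁺ : ∀ t (m : Move t) {z} → z ∈ labels t → z ∈ labels (applyMove t m)
∈-applyMove⁺ t m {z} z∈ = ∈-resp-↭ (↭-sym (labels-applyMove t m)) (moved-or-kept (z ≟ Move.lab m))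
  where
  moved-or-kept : Dec (z ≡ Move.lab m) → z ∈ Move.lab m ∷ labelsM (remove (Move.lab m) t)
  moved-or-kept (yes z≡ℓ) = here z≡ℓ
  moved-or-kept (no z≢ℓ)  = there (subst (λ u → z ∈ labelsM u) (sym (remove≡restrict (Move.lab m) t))
                                        (∈-restrict⁺ (other (Move.lab m)) t z∈ (other-true z≢ℓ)))

∈-applyMove⁻ : ∀ t (m : Move t) {z} → z ∈ labels (applyMove t m) → z ∈ labels t
∈-applyMove⁻ t m z∈ with ∈-resp-↭ (labels-applyMove t m) z∈
... | here refl = Move.lab∈ m
... | there z∈′ = ∈-restrict⁻ (other (Move.lab m)) t
                    (subst (λ u → _ ∈ labelsM u) (remove≡restrict (Move.lab m) t) z∈′)

moved⊆labels : ∀ {t} (s : LPRSeq t) → moved s ⊆ labels t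
moved⊆labels (m ∷ s) (here refl) = Move.lab∈ m
moved⊆labels {t} (m ∷ s) (there z∈) = ∈-applyMove⁻ t m (moved⊆labels s z∈)

restrict-applyMove : ∀ P t (m : Move t) → P (Move.lab m) ≡ false → restrict P (applyMove t m) ≡ restrict P t
restrict-applyMove P t (move ℓ _ L) Pℓ = begin
  restrict P (graft ℓ (remove ℓ t) L)  ≡⟨ restrict-graft-dropped P (remove ℓ t) L Pℓ ⟩
  restrictM P (remove ℓ t)             ≡⟨ restrict-remove P ℓ t ⟩
  restrict (λ x → other ℓ x ∧ P x) t   ≡⟨ restrict-cong (other-∧ P Pℓ) t ⟩
  restrict P t                         ∎
  where open ≡-Reasoning

restrict-result : ∀ P {t} (s : LPRSeq t) → (∀ {z} → z ∈ moved s → P z ≡ false) → restrict P (result s) ≡ restrict P t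
restrict-result P []            _       = refl
restrict-result P {t} (m ∷ s) dropped =
  trans (restrict-result P s (dropped ∘ there)) (restrict-applyMove P t m (dropped (here refl)))

agreeOff : ∀ {T₁ T₂ ys} (s : LPRSeq T₁) → moved s ⊆ ys → Turns s T₂ →
  restrict (outside ys) T₁ ≅ᴹ restrict (outside ys) T₂
agreeOff {T₁} {T₂} {ys} s moved⊆ys turns = begin
  restrict (outside ys) T₁          ≡⟨ restrict-result (outside ys) s (outside-false ∘ moved⊆ys) ⟨
  restrict (outside ys) (result s)  ≈⟨ restrict-≅ (outside ys) turns ⟩
  restrict (outside ys) T₂          ∎
  where open SetoidReasoning ≅ᴹ-setoid

regraft : ∀ y ys T T₂ → Phylo T₂ → y ∈ labels T₂ → y ∉ ys →
  restrict (outside (y ∷ ys)) T ≅ᴹ restrict (outside (y ∷ ys)) T₂ →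
  Σ (Loc (remove y T)) λ L → restrict (outside ys) (graft y (remove y T) L) ≅ᴹ restrict (outside ys) T₂
regraft y ys T T₂ u₂ y∈T₂ y∉ys agree =
  let
      q₂ , at-q₂ = siteOfM y T₂|ys (restrict-unique (outside ys) T₂ u₂) (∈-restrict⁺ (outside ys) T₂ y∈T₂ kept-y)
      q , q≅q₂   = transportSite y same q₂
      p , lifted = liftSite (outside ys) y kept-y (remove y T) q
  in toLoc (remove y T) p , (begin
    restrict (outside ys) (graft y (remove y T) (toLoc (remove y T) p))
      ≡⟨ cong (restrict (outside ys)) (graft-toLoc y (remove y T) p) ⟩
    restrict (outside ys) (attach y (remove y T) p)          ≡⟨ lifted ⟩
    just (attach y (restrictM (outside ys) (remove y T)) q)  ≈⟨ just q≅q₂ ⟩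
    just (attach y (restrictM (other y) T₂|ys) q₂)           ≈⟨ at-q₂ ⟩
    T₂|ys                                                     ∎)
  where
  open SetoidReasoning ≅ᴹ-setoid

  T₂|ys : Maybe Tree
  T₂|ys = restrict (outside ys) T₂

  kept-y : outside ys y ≡ true
  kept-y = outside-true y∉ys

  same : restrictM (outside ys) (remove y T) ≅ᴹ restrictM (other y) T₂|ys
  same = begin
    restrictM (outside ys) (remove y T)   ≡⟨ restrict-remove-outside y ys T ⟩
    restrict (outside (y ∷ ys)) T         ≈⟨ agree ⟩
    restrict (outside (y ∷ ys)) T₂        ≡⟨ restrict-other-outside y ys T₂ ⟨
    restrictM (other y) T₂|ys             ∎

placeFirst : ∀ y ys T T₂ → Phylo T₂ → y ∈ labels T₂ →
  restrict (outside (y ∷ ys)) T ≅ᴹ restrict (outside (y ∷ ys)) T₂ →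
  Σ (Loc (remove y T)) λ L → restrict (outside ys) (graft y (remove y T) L) ≅ᴹ restrict (outside ys) T₂
placeFirst y ys T T₂ u₂ y∈T₂ agree with y ∈? ys
... | no  y∉ys = regraft y ys T T₂ u₂ y∈T₂ y∉ys agree
... | yes y∈ys = L , (begin
  restrict (outside ys) (graft y (remove y T) L)  ≡⟨ restrict-graft-dropped (outside ys) (remove y T) L (outside-false y∈ys) ⟩
  restrictM (outside ys) (remove y T)             ≡⟨ restrict-remove-outside y ys T ⟩
  restrict (outside (y ∷ ys)) T                   ≈⟨ agree ⟩
  restrict (outside (y ∷ ys)) T₂                  ≡⟨ restrict-cong (outside-dup y∈ys) T₂ ⟩
  restrict (outside ys) T₂                        ∎)
  where
  open SetoidReasoning ≅ᴹ-setoid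
  -- y is moved again later, so its position now is irrelevant
  L = aboveRoot (remove y T)

realise : ∀ T₂ → Phylo T₂ → ∀ ys T → ys ⊆ labels T → ys ⊆ labels T₂ →
  restrict (outside ys) T ≅ᴹ restrict (outside ys) T₂ →
  Σ (LPRSeq T) λ s → moved s ≡ ys × Turns s T₂
realise T₂ u₂ [] T _ _ agree = [] , refl , drop-just (begin
  just T                   ≡⟨ restrict-all (outside []) T (λ _ → refl) ⟨
  restrict (outside []) T  ≈⟨ agree ⟩
  restrict (outside []) T₂ ≡⟨ restrict-all (outside []) T₂ (λ _ → refl) ⟩
  just T₂                  ∎)
  where open SetoidReasoning ≅ᴹ-setoid
realise T₂ u₂ (y ∷ ys) T ys⊆T ys⊆T₂ agree =
  let L , agree′      = placeFirst y ys T T₂ u₂ (ys⊆T₂ (here refl)) agree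
      m               = move y (ys⊆T (here refl)) L
      s , moved≡ , turns = realise T₂ u₂ ys (applyMove T m) (∈-applyMove⁺ T m ∘ ys⊆T ∘ there) (ys⊆T₂ ∘ there) agree′
  in m ∷ s , cong (y ∷_) moved≡ , turns

reorder : ∀ {T₁ T₂} → Phylo T₂ → labels T₁ ↭ labels T₂ → (s : LPRSeq T₁) → Turns s T₂ →
  ∀ {ys} → ys ↭ moved s → Σ (LPRSeq T₁) λ s′ → moved s′ ≡ ys × Turns s′ T₂
reorder {T₁} {T₂} u₂ same-labels s turns {ys} ys↭moved =
  realise T₂ u₂ ys T₁ ys⊆T₁ (∈-resp-↭ same-labels ∘ ys⊆T₁) (agreeOff s (∈-resp-↭ (↭-sym ys↭moved)) turns)
  where
  ys⊆T₁ : ys ⊆ labels T₁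
  ys⊆T₁ = moved⊆labels s ∘ ∈-resp-↭ ys↭moved

lookup∷removeAt↭ : ∀ (xs : List ℕ) i → lookup xs i ∷ removeAt xs i ↭ xs
lookup∷removeAt↭ (x ∷ xs) zero    = ↭-refl
lookup∷removeAt↭ (x ∷ xs) (suc i) = ↭-trans (swap (lookup xs i) x ↭-refl) (prep x (lookup∷removeAt↭ xs i))

lemma4 : (T₁ T₂ : Tree) → Phylo T₁ → Phylo T₂ → labels T₁ ↭ labels T₂ →
    (s : LPRSeq T₁) → Turns s T₂ → (i : Fin (length (moved s))) →
    Σ (LPRSeq T₁) λ s′ → Turns s′ T₂ × length (moved s′) ≡ length (moved s)
      × (∃ λ rest → moved s′ ≡ lookup (moved s) i ∷ rest)
      × (∀ x → (x ∈ moved s) ⇔ (x ∈ moved s′))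
lemma4 T₁ T₂ _ u₂ same-labels s turns i
  with reorder u₂ same-labels s turns (lookup∷removeAt↭ (moved s) i)
... | s′ , moved≡ , turns′ =
  s′ , turns′ , ↭-length s′↭s , (removeAt (moved s) i , moved≡) ,
  λ _ → mk⇔ (∈-resp-↭ (↭-sym s′↭s)) (∈-resp-↭ s′↭s)
  where
  s′↭s : moved s′ ↭ moved s
  s′↭s = subst (_↭ moved s) (sym moved≡) (lookup∷removeAt↭ (moved s) i)
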